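{- Let $p$ be a prime, let $w_1,w_2,w_3$ be positive integers, let $y\in\mathbb{Z}_p$, and let $n\ge0$ be an integer. Then \begin{align*} &\sum_{k+\ell+m=n}\binom{n}{k,\ell,m}B_{k}(w_{1}y)B_{\ell}(w_{2}y)B_{m}(w_{3}y)\,w_{3}^{k}w_{1}^{\ell}w_{2}^{m}\\ &=\sum_{k+\ell+m=n}\binom{n}{k,\ell,m}B_{k}(w_{1}y)B_{\ell}(w_{3}y)B_{m}(w_{2}y)\,w_{2}^{k}w_{1}^{\ell}w_{3}^{m}. \end{align*}
   Context: $\mathbb{Z}_p$ denotes the ring of $p$-adic integers. The Bernoulli polynomials $B_n(x)$ are defined by $\frac{t}{e^t-1}e^{xt}=\sum_{n\ge0}B_n(x)\frac{t^n}{n!}$. Sums $\sum_{k+\ell+m=n}$ run over all nonnegative integers $k,\ell,m$ with $k+\ell+m=n$, and $\binom{n}{k,\ell,m}=\frac{n!}{k!\,\ell!\,m!}$. -}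

module Defs where

open import Level using (Level)
import Level
import Data.Nat
open import Data.Nat using (ℕ; zero; suc; _∸_)
open import Data.Nat.Combinatorics using (_C_)
open import Data.Integer using (+_; -[1+_])
open import Data.List using (List; []; _∷_; _++_; [_]; upTo; zipWith; map; foldr)
open import Data.Rational using (ℚ; _/_)
import Data.Rational as Q
open import Data.Rational.Properties using (+-*-commutativeRing)
open import Algebra.Bundles using (CommutativeRing)
open import Algebra.Morphism.Structures using (module RingMorphisms)

ℕ→ℚ : ℕ → ℚ
ℕ→ℚ n = (+ n) / 1

sumℚ : List ℚ → ℚ
sumℚ = foldr Q._+_ Q.0ℚ

-- Bernoulli numbers B_n, defined by B_0 = 1 and
--   sum_{j=0}^{n} C(n+1,j) B_j = 0  for n ≥ 1,
-- i.e. B_n = -(1/(n+1)) * sum_{j<n} C(n+1,j) B_j.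
-- This is the convention t/(e^t-1) = sum B_n t^n/n!  (so B_1 = -1/2).
-- bernList n = [B_0, ..., B_{n-1}]
mutual
  bernList : ℕ → List ℚ
  bernList zero = []
  bernList (suc n) = bernList n ++ [ bernoulli n ]

  bernoulli : ℕ → ℚ
  bernoulli zero = Q.1ℚ
  bernoulli (suc n) =
    Q._*_ (-[1+ 0 ] / suc (suc n))
          (sumℚ (zipWith (λ j b → Q._*_ (ℕ→ℚ (suc (suc n) C j)) b)
                         (upTo (suc n)) (bernList (suc n))))

module _ {c ℓ : Level} (R : CommutativeRing c ℓ) where
  open CommutativeRing R

  -- R is a ℚ-algebra via a ring homomorphism ℚ → R
  IsℚAlgebraMap : (ℚ → Carrier) → Set ℓ
  IsℚAlgebraMap f =
    RingMorphisms.IsRingHomomorphism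
      (CommutativeRing.rawRing +-*-commutativeRing) rawRing f

  pow : Carrier → ℕ → Carrier
  pow x zero = 1#
  pow x (suc k) = x * pow x k

  sumR : List Carrier → Carrier
  sumR = foldr _+_ 0#

  bernPoly : (ℚ → Carrier) → ℕ → Carrier → Carrier
  bernPoly f n x =
    sumR (map (λ j → f (Q._*_ (ℕ→ℚ (n C j)) (bernoulli j)) * pow x (n ∸ j)) (upTo (suc n)))

  ℕ→R : (ℚ → Carrier) → ℕ → Carrier
  ℕ→R f w = f (ℕ→ℚ w)

  sumTriples : ℕ → (ℕ → ℕ → ℕ → Carrier) → Carrier
  sumTriples n g =
    sumR (map (λ k → sumR (map (λ l → g k l (n ∸ k ∸ l)) (upTo (suc (n ∸ k)))))
              (upTo (suc n)))

-- multinomial coefficient n!/(k! l! m!) for k + l + m = n, written as C(n,k) * C(n-k,l)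
multinomial : ℕ → ℕ → ℕ → ℕ → ℕ
multinomial n k l m = (n C k) Data.Nat.* ((n ∸ k) C l)

-- Write Aᵤ(j) = uʲ Bⱼ and pᶜ(k) = cᵏ. Since Bₖ(x) = Σⱼ C(k,j) Bⱼ x^(k-j), the sequence
-- uᵏ Bₖ(x) is the binomial convolution Aᵤ ⋆ p^(u x). Binomial convolution multiplies
-- exponential generating functions, so it is commutative and associative. With x = v y
-- each triple sum is a double convolution of such sequences, and both sides regroup into
--   A_w₁ ⋆ A_w₂ ⋆ A_w₃ ⋆ p^(w₁w₂ y) ⋆ p^(w₂w₃ y) ⋆ p^(w₃w₁ y),
-- which is symmetric in w₁, w₂, w₃.
module Submission where

open import Defs
open import Level using (Level)
open import Data.Nat using (ℕ; NonZero) renaming (_*_ to _*ℕ_; _^_ to _^ℕ_)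
open import Data.Rational using (ℚ)
open import Data.Nat.Primality using (Prime)
open import Algebra.Bundles using (CommutativeRing)

open import Algebra.Bundles using (CommutativeSemiring; CommutativeMonoid)
open import Algebra.Morphism.Structures using (module RingMorphisms; module MonoidMorphisms)
import Algebra.Properties.CommutativeSemigroup as CommutativeSemigroupProperties
import Algebra.Solver.CommutativeMonoid as CommutativeMonoidSolver
open MonoidMorphisms using (IsMonoidHomomorphism)
open import Data.Integer using (+_)
import Data.Integer as ℤ
open import Data.Integer.Properties using (pos-*)
open import Data.List using (applyUpTo; foldr; map; upTo)
open import Data.List.Properties using (map-upTo)
import Data.Nat as ℕ
open import Data.Nat using (zero; suc; _≤_; _<_; _∸_; _!; z<s; s<s; s≤s⁻¹)
open import Data.Nat.Combinatorics using (_C_; nCk≡n!/k![n-k]!; k![n∸k]!∣n!; nCk≡nC[n∸k])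
import Data.Nat.Coprimality as Coprime
open import Data.Nat.DivMod using (m/n*n≡m)
open import Data.Nat.Properties
  using ( _!≢0; _!*_!≢0; m*n≢0; *-cancelʳ-≡; ≤-trans; m≤m+n; m+n∸m≡n; ∸-monoˡ-≤
        ; ∸-+-assoc; +-∸-assoc; n∸n≡0; m∸[m∸n]≡n; ^-distribˡ-+-*; m+[n∸m]≡n; +-monoʳ-≤ )
open import Data.Nat.Solver using (module +-*-Solver)
open import Data.Product using (_,_)
import Data.Rational as Q
open import Data.Rational.Properties using (normalize-coprime)
open import Relation.Binary.PropositionalEquality as ≡ using (_≡_)

ℕ→ℚ-homo-* : ∀ m n → ℕ→ℚ (m ℕ.* n) ≡ ℕ→ℚ m Q.* ℕ→ℚ n
ℕ→ℚ-homo-* m n = begin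
  + (m ℕ.* n) / 1           ≡⟨ ≡.cong (_/ 1) (pos-* m n) ⟩
  (+ m ℤ.* + n) / 1         ≡⟨⟩
  integral m Q.* integral n ≡⟨ ≡.cong₂ Q._*_ (normalize-coprime (coprime m)) (normalize-coprime (coprime n)) ⟨
  ℕ→ℚ m Q.* ℕ→ℚ n           ∎
  where
  open ≡.≡-Reasoning
  open Q using (_/_)
  coprime : ∀ k → Coprime.Coprime k 1
  coprime k = Coprime.sym (Coprime.1-coprimeTo k)
  integral : ℕ → ℚ
  integral k = Q.mkℚ (+ k) 0 (coprime k)

nCk*[k!*[n∸k]!]≡n! : ∀ {n k} → k ≤ n → (n C k) ℕ.* (k ! ℕ.* (n ∸ k) !) ≡ n !
nCk*[k!*[n∸k]!]≡n! {n} {k} k≤n =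
  ≡.trans (≡.cong (ℕ._* (k ! ℕ.* (n ∸ k) !)) (nCk≡n!/k![n-k]! k≤n))
          (m/n*n≡m {{k !* (n ∸ k) !≢0}} (k![n∸k]!∣n! k≤n))

-- Multiplied by i! t! (n ∸ (i + t))!, both sides become n!.
nC[i+t]*[i+t]Ci≡nCi*[n∸i]Ct : ∀ n i t → i ℕ.+ t ≤ n →
  (n C (i ℕ.+ t)) ℕ.* ((i ℕ.+ t) C i) ≡ (n C i) ℕ.* ((n ∸ i) C t)
nC[i+t]*[i+t]Ci≡nCi*[n∸i]Ct n i t i+t≤n =
  *-cancelʳ-≡ _ _ (i ! ℕ.* t ! ℕ.* r !) {{i!t!r!≢0}} (≡.trans lhs≡n! (≡.sym rhs≡n!))
  where
  open +-*-Solver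
  open ≡.≡-Reasoning
  r : ℕ
  r = n ∸ (i ℕ.+ t)
  i!t!r!≢0 : NonZero (i ! ℕ.* t ! ℕ.* r !)
  i!t!r!≢0 = m*n≢0 (i ! ℕ.* t !) (r !) {{i !* t !≢0}} {{r !≢0}}
  t≤n∸i : t ≤ n ∸ i
  t≤n∸i = ≡.subst (_≤ n ∸ i) (m+n∸m≡n i t) (∸-monoˡ-≤ i i+t≤n)
  lhs≡n! : (n C (i ℕ.+ t)) ℕ.* ((i ℕ.+ t) C i) ℕ.* (i ! ℕ.* t ! ℕ.* r !) ≡ n !
  lhs≡n! = begin
    X ℕ.* Y ℕ.* (i ! ℕ.* t ! ℕ.* r !)
      ≡⟨ solve 5 (λ x y a b c → (x :* y) :* (a :* b :* c) := x :* ((y :* (a :* b)) :* c)) ≡.refl X Y (i !) (t !) (r !) ⟩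
    X ℕ.* (Y ℕ.* (i ! ℕ.* t !) ℕ.* r !)
      ≡⟨ ≡.cong (λ s → X ℕ.* (s ℕ.* r !)) [i+t]Ci*[i!*t!]≡[i+t]! ⟩
    X ℕ.* ((i ℕ.+ t) ! ℕ.* r !)
      ≡⟨ nCk*[k!*[n∸k]!]≡n! i+t≤n ⟩
    n ! ∎
    where
    X = n C (i ℕ.+ t)
    Y = (i ℕ.+ t) C i
    [i+t]Ci*[i!*t!]≡[i+t]! : Y ℕ.* (i ! ℕ.* t !) ≡ (i ℕ.+ t) !
    [i+t]Ci*[i!*t!]≡[i+t]! = ≡.trans (≡.cong (λ s → Y ℕ.* (i ! ℕ.* s !)) (≡.sym (m+n∸m≡n i t)))
                                     (nCk*[k!*[n∸k]!]≡n! (m≤m+n i t))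
  rhs≡n! : (n C i) ℕ.* ((n ∸ i) C t) ℕ.* (i ! ℕ.* t ! ℕ.* r !) ≡ n !
  rhs≡n! = begin
    X ℕ.* Y ℕ.* (i ! ℕ.* t ! ℕ.* r !)
      ≡⟨ solve 5 (λ x y a b c → (x :* y) :* (a :* b :* c) := x :* (a :* (y :* (b :* c)))) ≡.refl X Y (i !) (t !) (r !) ⟩
    X ℕ.* (i ! ℕ.* (Y ℕ.* (t ! ℕ.* r !)))
      ≡⟨ ≡.cong (λ s → X ℕ.* (i ! ℕ.* s)) [n∸i]Ct*[t!*r!]≡[n∸i]! ⟩
    X ℕ.* (i ! ℕ.* (n ∸ i) !)
      ≡⟨ nCk*[k!*[n∸k]!]≡n! (≤-trans (m≤m+n i t) i+t≤n) ⟩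
    n ! ∎
    where
    X = n C i
    Y = (n ∸ i) C t
    [n∸i]Ct*[t!*r!]≡[n∸i]! : Y ℕ.* (t ! ℕ.* r !) ≡ (n ∸ i) !
    [n∸i]Ct*[t!*r!]≡[n∸i]! = ≡.trans (≡.cong (λ s → Y ℕ.* (t ! ℕ.* s !)) (≡.sym (∸-+-assoc n i t)))
                                     (nCk*[k!*[n∸k]!]≡n! t≤n∸i)

module FiniteSums {c ℓ} (S : CommutativeSemiring c ℓ) where
  open CommutativeSemiring S
  open CommutativeSemigroupProperties +-commutativeSemigroup using (interchange)
  open import Relation.Binary.Reasoning.Setoid setoid

  opaque
    Σ : ℕ → (ℕ → Carrier) → Carrier
    Σ n g = foldr _+_ 0# (applyUpTo g n)

    Σ≡foldr : ∀ n g → Σ n g ≡ foldr _+_ 0# (applyUpTo g n)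
    Σ≡foldr n g = ≡.refl

    Σ-suc : ∀ n g → Σ (suc n) g ≈ g 0 + Σ n (λ j → g (suc j))
    Σ-suc n g = refl

    Σ-cong : ∀ n {g h : ℕ → Carrier} → (∀ j → j < n → g j ≈ h j) → Σ n g ≈ Σ n h
    Σ-cong zero    g≈h = refl
    Σ-cong (suc n) g≈h = +-cong (g≈h 0 z<s) (Σ-cong n (λ j j<n → g≈h (suc j) (s<s j<n)))

    Σ-snoc : ∀ n g → Σ (suc n) g ≈ Σ n g + g n
    Σ-snoc zero    g = +-comm _ _
    Σ-snoc (suc n) g = trans (+-congˡ (Σ-snoc n (λ j → g (suc j)))) (sym (+-assoc _ _ _))

    Σ-zero : ∀ n → Σ n (λ _ → 0#) ≈ 0#
    Σ-zero zero    = refl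
    Σ-zero (suc n) = trans (+-identityˡ _) (Σ-zero n)

    Σ-distrib-+ : ∀ n g h → Σ n (λ j → g j + h j) ≈ Σ n g + Σ n h
    Σ-distrib-+ zero    g h = sym (+-identityˡ 0#)
    Σ-distrib-+ (suc n) g h =
      trans (+-congˡ (Σ-distrib-+ n (λ j → g (suc j)) (λ j → h (suc j)))) (interchange _ _ _ _)

    *-distribˡ-Σ : ∀ n x g → x * Σ n g ≈ Σ n (λ j → x * g j)
    *-distribˡ-Σ zero    x g = zeroʳ x
    *-distribˡ-Σ (suc n) x g = trans (distribˡ x _ _) (+-congˡ (*-distribˡ-Σ n x (λ j → g (suc j))))

    *-distribʳ-Σ : ∀ n x g → Σ n g * x ≈ Σ n (λ j → g j * x)
    *-distribʳ-Σ n x g =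
      trans (*-comm _ x) (trans (*-distribˡ-Σ n x g) (Σ-cong n (λ j _ → *-comm x (g j))))

    Σ-reverse : ∀ n g → Σ (suc n) g ≈ Σ (suc n) (λ j → g (n ∸ j))
    Σ-reverse zero    g = refl
    Σ-reverse (suc n) g = begin
      g 0 + Σ (suc n) (λ j → g (suc j))        ≈⟨ +-congˡ (Σ-reverse n (λ j → g (suc j))) ⟩
      g 0 + Σ (suc n) (λ j → g (suc (n ∸ j)))  ≈⟨ +-congˡ (Σ-cong (suc n) sucₗ) ⟩
      g 0 + Σ (suc n) (λ j → g (suc n ∸ j))    ≈⟨ +-comm _ _ ⟩
      Σ (suc n) (λ j → g (suc n ∸ j)) + g 0    ≈⟨ +-congˡ (reflexive (≡.cong g (≡.sym (n∸n≡0 n)))) ⟩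
      Σ (suc n) (λ j → g (suc n ∸ j)) + g (n ∸ n) ≈⟨ Σ-snoc (suc n) (λ j → g (suc n ∸ j)) ⟨
      Σ (suc (suc n)) (λ j → g (suc n ∸ j))    ∎
      where
      sucₗ : ∀ j → j < suc n → g (suc (n ∸ j)) ≈ g (suc n ∸ j)
      sucₗ j j<1+n = reflexive (≡.cong g (≡.sym (+-∸-assoc 1 (s≤s⁻¹ j<1+n))))

    -- Peeling off i = 0 from both sides leaves the same statement for λ i j → F (suc i) (suc j).
    Σ-triangle : ∀ n (F : ℕ → ℕ → Carrier) →
      Σ (suc n) (λ j → Σ (suc j) (λ i → F i j)) ≈ Σ (suc n) (λ i → Σ (suc (n ∸ i)) (λ t → F i (i ℕ.+ t)))
    Σ-triangle zero    F = refl
    Σ-triangle (suc n) F = begin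
      Σ (suc (suc n)) (λ j → F 0 j + Σ j (λ i → F (suc i) j))
        ≈⟨ Σ-distrib-+ (suc (suc n)) (F 0) (λ j → Σ j (λ i → F (suc i) j)) ⟩
      Σ (suc (suc n)) (F 0) + (0# + Σ (suc n) (λ j → Σ (suc j) (λ i → F (suc i) (suc j))))
        ≈⟨ +-congˡ (+-identityˡ _) ⟩
      Σ (suc (suc n)) (F 0) + Σ (suc n) (λ j → Σ (suc j) (λ i → F (suc i) (suc j)))
        ≈⟨ +-congˡ (Σ-triangle n (λ i j → F (suc i) (suc j))) ⟩
      Σ (suc (suc n)) (F 0) + Σ (suc n) (λ i → Σ (suc (n ∸ i)) (λ t → F (suc i) (suc (i ℕ.+ t)))) ∎

module BinomialConvolution {c ℓ} (S : CommutativeSemiring c ℓ) (ι : ℕ → CommutativeSemiring.Carrier S)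
  (ι-homo : IsMonoidHomomorphism ℕ.*-1-rawMonoid (CommutativeSemiring.*-rawMonoid S) ι) where

  open CommutativeSemiring S
  open IsMonoidHomomorphism ι-homo renaming (ε-homo to ι-1; homo to ι-*)
  open FiniteSums S
  open CommutativeSemigroupProperties *-commutativeSemigroup using (x∙yz≈y∙xz)
  open import Relation.Binary.Reasoning.Setoid setoid

  Seq : Set c
  Seq = ℕ → Carrier

  infix 4 _≋_
  _≋_ : Seq → Seq → Set ℓ
  a ≋ b = ∀ n → a n ≈ b n

  infixl 7 _⋆_
  _⋆_ : Seq → Seq → Seq
  (a ⋆ b) n = Σ (suc n) (λ j → ι (n C j) * (a j * b (n ∸ j)))

  δ : Seq
  δ zero    = 1#
  δ (suc _) = 0#

  ⋆-cong : ∀ {a a′ b b′} → a ≋ a′ → b ≋ b′ → a ⋆ b ≋ a′ ⋆ b′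
  ⋆-cong a≋a′ b≋b′ n = Σ-cong (suc n) (λ j _ → *-congˡ {ι (n C j)} (*-cong (a≋a′ j) (b≋b′ (n ∸ j))))

  ⋆-identityˡ : ∀ a → δ ⋆ a ≋ a
  ⋆-identityˡ a n = trans (Σ-suc n _) (trans (+-cong head tail) (+-identityʳ (a n)))
    where
    head : ι (n C 0) * (1# * a n) ≈ a n
    head = trans (*-cong ι-1 (*-identityˡ (a n))) (*-identityˡ (a n))
    tail : Σ n (λ j → ι (n C suc j) * (0# * a (n ∸ suc j))) ≈ 0#
    tail = trans (Σ-cong n (λ j _ → trans (*-congˡ (zeroˡ _)) (zeroʳ _))) (Σ-zero n)

  ⋆-comm : ∀ a b → a ⋆ b ≋ b ⋆ a
  ⋆-comm a b n = trans (Σ-reverse n _) (Σ-cong (suc n) reflected)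
    where
    reflected : ∀ j → j < suc n →
      ι (n C (n ∸ j)) * (a (n ∸ j) * b (n ∸ (n ∸ j))) ≈ ι (n C j) * (b j * a (n ∸ j))
    reflected j j<1+n = *-cong (reflexive (≡.cong ι (≡.sym (nCk≡nC[n∸k] j≤n))))
      (trans (*-comm _ _) (*-congʳ (reflexive (≡.cong b (m∸[m∸n]≡n j≤n)))))
      where j≤n = s≤s⁻¹ j<1+n

  ⋆-assoc-summand : ∀ n i t → i ℕ.+ t ≤ n → ∀ x y z →
    ι (n C (i ℕ.+ t)) * ((ι ((i ℕ.+ t) C i) * (x * y)) * z)
      ≈ ι (n C i) * (x * (ι ((n ∸ i) C t) * (y * z)))
  ⋆-assoc-summand n i t i+t≤n x y z = begin
    ι (n C (i ℕ.+ t)) * ((ι ((i ℕ.+ t) C i) * (x * y)) * z)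
      ≈⟨ *-congˡ (trans (*-assoc _ _ _) (*-congˡ (*-assoc _ _ _))) ⟩
    ι (n C (i ℕ.+ t)) * (ι ((i ℕ.+ t) C i) * (x * (y * z)))
      ≈⟨ *-assoc _ _ _ ⟨
    ι (n C (i ℕ.+ t)) * ι ((i ℕ.+ t) C i) * (x * (y * z))
      ≈⟨ *-congʳ (sym (ι-* _ _)) ⟩
    ι ((n C (i ℕ.+ t)) ℕ.* ((i ℕ.+ t) C i)) * (x * (y * z))
      ≈⟨ *-congʳ (reflexive (≡.cong ι (nC[i+t]*[i+t]Ci≡nCi*[n∸i]Ct n i t i+t≤n))) ⟩
    ι ((n C i) ℕ.* ((n ∸ i) C t)) * (x * (y * z))
      ≈⟨ *-congʳ (ι-* _ _) ⟩
    ι (n C i) * ι ((n ∸ i) C t) * (x * (y * z))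
      ≈⟨ trans (*-assoc _ _ _) (*-congˡ (x∙yz≈y∙xz _ _ _)) ⟩
    ι (n C i) * (x * (ι ((n ∸ i) C t) * (y * z))) ∎

  ⋆-assoc : ∀ a b d → (a ⋆ b) ⋆ d ≋ a ⋆ (b ⋆ d)
  ⋆-assoc a b d n = begin
    ((a ⋆ b) ⋆ d) n
      ≈⟨ Σ-cong (suc n) (λ j _ → expand j) ⟩
    Σ (suc n) (λ j → Σ (suc j) (λ i → G i j))
      ≈⟨ Σ-triangle n G ⟩
    Σ (suc n) (λ i → Σ (suc (n ∸ i)) (λ t → G i (i ℕ.+ t)))
      ≈⟨ Σ-cong (suc n) (λ i i<1+n → Σ-cong (suc (n ∸ i)) (λ t t<1+n∸i →
           regroup i t (bound i<1+n t<1+n∸i))) ⟩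
    Σ (suc n) (λ i → Σ (suc (n ∸ i)) (H i))
      ≈⟨ Σ-cong (suc n) (λ i _ → sym (collect i)) ⟩
    (a ⋆ (b ⋆ d)) n ∎
    where
    G : ℕ → ℕ → Carrier
    G i j = ι (n C j) * ((ι (j C i) * (a i * b (j ∸ i))) * d (n ∸ j))
    H : ℕ → ℕ → Carrier
    H i t = ι (n C i) * (a i * (ι ((n ∸ i) C t) * (b t * d (n ∸ i ∸ t))))
    expand : ∀ j → ι (n C j) * ((a ⋆ b) j * d (n ∸ j)) ≈ Σ (suc j) (λ i → G i j)
    expand j = trans (*-congˡ (*-distribʳ-Σ (suc j) _ _)) (*-distribˡ-Σ (suc j) _ _)
    collect : ∀ i → ι (n C i) * (a i * (b ⋆ d) (n ∸ i)) ≈ Σ (suc (n ∸ i)) (H i)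
    collect i = trans (*-congˡ (*-distribˡ-Σ (suc (n ∸ i)) _ _)) (*-distribˡ-Σ (suc (n ∸ i)) _ _)
    bound : ∀ {i t} → i < suc n → t < suc (n ∸ i) → i ℕ.+ t ≤ n
    bound {i} {t} i<1+n t<1+n∸i =
      ≡.subst (i ℕ.+ t ≤_) (m+[n∸m]≡n (s≤s⁻¹ i<1+n)) (+-monoʳ-≤ i (s≤s⁻¹ t<1+n∸i))
    regroup : ∀ i t → i ℕ.+ t ≤ n → G i (i ℕ.+ t) ≈ H i t
    regroup i t i+t≤n = trans
      (*-congˡ (*-cong (*-congˡ (*-congˡ (reflexive (≡.cong b (m+n∸m≡n i t)))))
                       (reflexive (≡.cong d (≡.sym (∸-+-assoc n i t))))))
      (⋆-assoc-summand n i t i+t≤n (a i) (b t) (d (n ∸ i ∸ t)))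

  ⋆-commutativeMonoid : CommutativeMonoid c ℓ
  ⋆-commutativeMonoid = record
    { Carrier = Seq
    ; _≈_ = _≋_
    ; _∙_ = _⋆_
    ; ε = δ
    ; isCommutativeMonoid = record
      { isMonoid = record
        { isSemigroup = record
          { isMagma = record
            { isEquivalence = record
              { refl = λ _ → refl ; sym = λ p n → sym (p n) ; trans = λ p q n → trans (p n) (q n) }
            ; ∙-cong = ⋆-cong }
          ; assoc = ⋆-assoc }
        ; identity = ⋆-identityˡ , (λ a n → trans (⋆-comm a δ n) (⋆-identityˡ a n)) }
      ; comm = ⋆-comm } }

module ScaledBernoulli {c ℓ : Level} (R : CommutativeRing c ℓ) (f : ℚ → CommutativeRing.Carrier R)
  (hom : IsℚAlgebraMap R f) where

  open CommutativeRing R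
  open CommutativeSemigroupProperties *-commutativeSemigroup using (interchange; x∙yz≈y∙xz)
  open import Relation.Binary.Reasoning.Setoid setoid
  module f = RingMorphisms.IsRingHomomorphism hom

  ι : ℕ → Carrier
  ι = ℕ→R R f

  ι-* : ∀ m n → ι (m ℕ.* n) ≈ ι m * ι n
  ι-* m n = trans (reflexive (≡.cong f (ℕ→ℚ-homo-* m n))) (f.*-homo _ _)

  ι-homo : IsMonoidHomomorphism ℕ.*-1-rawMonoid *-rawMonoid ι
  ι-homo = record
    { isMagmaHomomorphism = record
      { isRelHomomorphism = record { cong = λ m≡n → reflexive (≡.cong ι m≡n) }
      ; homo = ι-* }
    ; ε-homo = f.1#-homo }

  open FiniteSums commutativeSemiring
  open BinomialConvolution commutativeSemiring ι ι-homo

  sumR-upTo : ∀ n g → sumR R (map g (upTo n)) ≡ Σ n g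
  sumR-upTo n g = ≡.trans (≡.cong (sumR R) (map-upTo g n)) (≡.sym (Σ≡foldr n g))

  sumTriples≈ΣΣ : ∀ n g →
    sumTriples R n g ≈ Σ (suc n) (λ k → Σ (suc (n ∸ k)) (λ l → g k l (n ∸ k ∸ l)))
  sumTriples≈ΣΣ n g = trans (reflexive (sumR-upTo (suc n) _))
    (Σ-cong (suc n) (λ k _ → reflexive (sumR-upTo (suc (n ∸ k)) _)))

  sumTriples-cong : ∀ n {g h} → (∀ k l m → g k l m ≈ h k l m) → sumTriples R n g ≈ sumTriples R n h
  sumTriples-cong n {g} {h} g≈h = begin
    sumTriples R n g                                                   ≈⟨ sumTriples≈ΣΣ n g ⟩
    Σ (suc n) (λ k → Σ (suc (n ∸ k)) (λ l → g k l (n ∸ k ∸ l)))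
      ≈⟨ Σ-cong (suc n) (λ k _ → Σ-cong (suc (n ∸ k)) (λ l _ → g≈h k l _)) ⟩
    Σ (suc n) (λ k → Σ (suc (n ∸ k)) (λ l → h k l (n ∸ k ∸ l)))        ≈⟨ sumTriples≈ΣΣ n h ⟨
    sumTriples R n h                                                   ∎

  sumTriples-multinomial≈⋆ : ∀ n a b d →
    sumTriples R n (λ k l m → ι (multinomial n k l m) * (a k * (b l * d m))) ≈ (a ⋆ (b ⋆ d)) n
  sumTriples-multinomial≈⋆ n a b d =
    trans (sumTriples≈ΣΣ n (λ k l m → ι (multinomial n k l m) * (a k * (b l * d m))))
          (Σ-cong (suc n) (λ k _ → sym (collect k)))
    where
    collect : ∀ k → ι (n C k) * (a k * (b ⋆ d) (n ∸ k))
      ≈ Σ (suc (n ∸ k)) (λ l → ι (multinomial n k l (n ∸ k ∸ l)) * (a k * (b l * d (n ∸ k ∸ l))))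
    collect k = begin
      ι (n C k) * (a k * (b ⋆ d) (n ∸ k))
        ≈⟨ trans (*-congˡ (*-distribˡ-Σ (suc (n ∸ k)) _ _)) (*-distribˡ-Σ (suc (n ∸ k)) _ _) ⟩
      Σ (suc (n ∸ k)) (λ l → ι (n C k) * (a k * (ι ((n ∸ k) C l) * (b l * d (n ∸ k ∸ l)))))
        ≈⟨ Σ-cong (suc (n ∸ k)) (λ l _ → *-congˡ (x∙yz≈y∙xz _ _ _)) ⟩
      Σ (suc (n ∸ k)) (λ l → ι (n C k) * (ι ((n ∸ k) C l) * (a k * (b l * d (n ∸ k ∸ l)))))
        ≈⟨ Σ-cong (suc (n ∸ k)) (λ l _ →
             trans (sym (*-assoc _ _ _)) (*-congʳ (sym (ι-* (n C k) ((n ∸ k) C l))))) ⟩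
      Σ (suc (n ∸ k)) (λ l → ι (multinomial n k l (n ∸ k ∸ l)) * (a k * (b l * d (n ∸ k ∸ l)))) ∎

  β : Seq
  β j = f (bernoulli j)

  bernPoly≈β⋆pow : ∀ x → (λ k → bernPoly R f k x) ≋ β ⋆ pow R x
  bernPoly≈β⋆pow x k = trans (reflexive (sumR-upTo (suc k) _))
    (Σ-cong (suc k) (λ j _ → trans (*-congʳ (f.*-homo _ _)) (*-assoc _ _ _)))

  pow-cong : ∀ {x y} → x ≈ y → pow R x ≋ pow R y
  pow-cong x≈y zero    = refl
  pow-cong x≈y (suc m) = *-cong x≈y (pow-cong x≈y m)

  pow-distrib-* : ∀ x y → pow R (x * y) ≋ λ m → pow R x m * pow R y m
  pow-distrib-* x y zero    = sym (*-identityˡ 1#)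
  pow-distrib-* x y (suc m) = trans (*-congˡ (pow-distrib-* x y m)) (interchange _ _ _ _)

  pow-ι : ∀ u → pow R (ι u) ≋ λ m → ι (u ℕ.^ m)
  pow-ι u zero    = sym f.1#-homo
  pow-ι u (suc m) = trans (*-congˡ (pow-ι u m)) (sym (ι-* u (u ℕ.^ m)))

  scaledBernoulliNumber : ℕ → Seq
  scaledBernoulliNumber u j = ι (u ℕ.^ j) * β j

  scaledBernoulli : ℕ → Carrier → Seq
  scaledBernoulli u x k = ι (u ℕ.^ k) * bernPoly R f k x

  scaledBernoulli≈⋆pow : ∀ u x → scaledBernoulli u x ≋ scaledBernoulliNumber u ⋆ pow R (ι u * x)
  scaledBernoulli≈⋆pow u x k = begin
    ι (u ℕ.^ k) * bernPoly R f k x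
      ≈⟨ *-congˡ (bernPoly≈β⋆pow x k) ⟩
    ι (u ℕ.^ k) * (β ⋆ pow R x) k
      ≈⟨ *-distribˡ-Σ (suc k) _ _ ⟩
    Σ (suc k) (λ j → ι (u ℕ.^ k) * (ι (k C j) * (β j * pow R x (k ∸ j))))
      ≈⟨ Σ-cong (suc k) (λ j j<1+k → summand j (s≤s⁻¹ j<1+k)) ⟩
    (scaledBernoulliNumber u ⋆ pow R (ι u * x)) k ∎
    where
    summand : ∀ j → j ≤ k → ι (u ℕ.^ k) * (ι (k C j) * (β j * pow R x (k ∸ j)))
      ≈ ι (k C j) * (scaledBernoulliNumber u j * pow R (ι u * x) (k ∸ j))
    summand j j≤k = begin
      ι (u ℕ.^ k) * (ι (k C j) * (β j * pow R x (k ∸ j)))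
        ≈⟨ x∙yz≈y∙xz _ _ _ ⟩
      ι (k C j) * (ι (u ℕ.^ k) * (β j * pow R x (k ∸ j)))
        ≈⟨ *-congˡ (*-congʳ (reflexive (≡.cong ι uᵏ≡uʲ*uᵏ⁻ʲ))) ⟩
      ι (k C j) * (ι (u ℕ.^ j ℕ.* u ℕ.^ (k ∸ j)) * (β j * pow R x (k ∸ j)))
        ≈⟨ *-congˡ (trans (*-congʳ (ι-* (u ℕ.^ j) (u ℕ.^ (k ∸ j)))) (interchange _ _ _ _)) ⟩
      ι (k C j) * (scaledBernoulliNumber u j * (ι (u ℕ.^ (k ∸ j)) * pow R x (k ∸ j)))
        ≈⟨ *-congˡ (*-congˡ (trans (*-congʳ (sym (pow-ι u (k ∸ j)))) (sym (pow-distrib-* (ι u) x (k ∸ j))))) ⟩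
      ι (k C j) * (scaledBernoulliNumber u j * pow R (ι u * x) (k ∸ j)) ∎
      where
      uᵏ≡uʲ*uᵏ⁻ʲ : u ℕ.^ k ≡ u ℕ.^ j ℕ.* u ℕ.^ (k ∸ j)
      uᵏ≡uʲ*uᵏ⁻ʲ = ≡.trans (≡.cong (u ℕ.^_) (≡.sym (m+[n∸m]≡n j≤k))) (^-distribˡ-+-* u j (k ∸ j))

  ι-*-distribute-weights : ∀ M U V W x y z →
    ι (M ℕ.* (U ℕ.* V ℕ.* W)) * (x * (y * z)) ≈ ι M * ((ι U * x) * ((ι V * y) * (ι W * z)))
  ι-*-distribute-weights M U V W x y z = begin
    ι (M ℕ.* (U ℕ.* V ℕ.* W)) * (x * (y * z))
      ≈⟨ *-congʳ (trans (ι-* M (U ℕ.* V ℕ.* W)) (*-congˡ (trans (ι-* (U ℕ.* V) W) (*-congʳ (ι-* U V))))) ⟩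
    ι M * (ι U * ι V * ι W) * (x * (y * z))
      ≈⟨ trans (*-assoc _ _ _) (*-congˡ (*-congʳ (*-assoc _ _ _))) ⟩
    ι M * (ι U * (ι V * ι W) * (x * (y * z)))
      ≈⟨ *-congˡ (trans (interchange _ _ _ _) (*-congˡ (interchange _ _ _ _))) ⟩
    ι M * ((ι U * x) * ((ι V * y) * (ι W * z))) ∎

  sumTriples-bernPoly≈⋆ : ∀ n u v w x₁ x₂ x₃ →
    sumTriples R n (λ k l m → ι (multinomial n k l m ℕ.* (u ℕ.^ k ℕ.* v ℕ.^ l ℕ.* w ℕ.^ m))
                             * (bernPoly R f k x₁ * (bernPoly R f l x₂ * bernPoly R f m x₃)))
      ≈ (scaledBernoulli u x₁ ⋆ (scaledBernoulli v x₂ ⋆ scaledBernoulli w x₃)) n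
  sumTriples-bernPoly≈⋆ n u v w x₁ x₂ x₃ = trans
    (sumTriples-cong n (λ k l m → ι-*-distribute-weights (multinomial n k l m) (u ℕ.^ k) (v ℕ.^ l) (w ℕ.^ m)
                                    (bernPoly R f k x₁) (bernPoly R f l x₂) (bernPoly R f m x₃)))
    (sumTriples-multinomial≈⋆ n (scaledBernoulli u x₁) (scaledBernoulli v x₂) (scaledBernoulli w x₃))

  private module ⋆-Solver = CommutativeMonoidSolver ⋆-commutativeMonoid

  ⋆-scaledBernoulli-symmetric : ∀ w₁ w₂ w₃ y →
    scaledBernoulli w₃ (ι w₁ * y) ⋆ (scaledBernoulli w₁ (ι w₂ * y) ⋆ scaledBernoulli w₂ (ι w₃ * y))
      ≋ scaledBernoulli w₂ (ι w₁ * y) ⋆ (scaledBernoulli w₁ (ι w₃ * y) ⋆ scaledBernoulli w₃ (ι w₂ * y))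
  ⋆-scaledBernoulli-symmetric w₁ w₂ w₃ y n = begin
    (P w₃ w₁ ⋆ (P w₁ w₂ ⋆ P w₂ w₃)) n
      ≈⟨ ⋆-cong (expand w₃ w₁) (⋆-cong (expand w₁ w₂) (expand w₂ w₃)) n ⟩
    (A w₃ ⋆ E w₃ w₁ ⋆ (A w₁ ⋆ E w₁ w₂ ⋆ (A w₂ ⋆ E w₂ w₃))) n
      ≈⟨ ⋆-Solver.solve 6 (λ a₁ a₂ a₃ e₁₂ e₂₃ e₃₁ →
           (a₃ ⊕ e₃₁) ⊕ ((a₁ ⊕ e₁₂) ⊕ (a₂ ⊕ e₂₃)) ⊜ (a₂ ⊕ e₁₂) ⊕ ((a₁ ⊕ e₃₁) ⊕ (a₃ ⊕ e₂₃)))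
           (λ _ → refl) (A w₁) (A w₂) (A w₃) (E w₁ w₂) (E w₂ w₃) (E w₃ w₁) n ⟩
    (A w₂ ⋆ E w₁ w₂ ⋆ (A w₁ ⋆ E w₃ w₁ ⋆ (A w₃ ⋆ E w₂ w₃))) n
      ≈⟨ ⋆-cong (expand-swapped w₂ w₁) (⋆-cong (expand-swapped w₁ w₃) (expand-swapped w₃ w₂)) n ⟨
    (P w₂ w₁ ⋆ (P w₁ w₃ ⋆ P w₃ w₂)) n ∎
    where
    open ⋆-Solver using (_⊕_; _⊜_)
    P : ℕ → ℕ → Seq
    P u v = scaledBernoulli u (ι v * y)
    A : ℕ → Seq
    A = scaledBernoulliNumber
    E : ℕ → ℕ → Seq
    E u v = pow R (ι u * (ι v * y))
    expand : ∀ u v → P u v ≋ A u ⋆ E u v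
    expand u v = scaledBernoulli≈⋆pow u (ι v * y)
    expand-swapped : ∀ u v → P u v ≋ A u ⋆ E v u
    expand-swapped u v k = trans (expand u v k) (⋆-cong {A u} (λ _ → refl) (pow-cong (x∙yz≈y∙xz _ _ _)) k)

theorem16 : {c ℓ : Level} (R : CommutativeRing c ℓ) (f : ℚ → CommutativeRing.Carrier R) → IsℚAlgebraMap R f →
  (p : ℕ) → Prime p →
  (w₁ w₂ w₃ : ℕ) → .{{_ : NonZero w₁}} → .{{_ : NonZero w₂}} → .{{_ : NonZero w₃}} →
  (y : CommutativeRing.Carrier R) → (n : ℕ) →
  let open CommutativeRing R in
  sumTriples R n (λ k l m →
      ℕ→R R f (multinomial n k l m *ℕ (w₃ ^ℕ k *ℕ w₁ ^ℕ l *ℕ w₂ ^ℕ m))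
      * (bernPoly R f k (ℕ→R R f w₁ * y)
      * (bernPoly R f l (ℕ→R R f w₂ * y)
      * bernPoly R f m (ℕ→R R f w₃ * y))))
  ≈
  sumTriples R n (λ k l m →
      ℕ→R R f (multinomial n k l m *ℕ (w₂ ^ℕ k *ℕ w₁ ^ℕ l *ℕ w₃ ^ℕ m))
      * (bernPoly R f k (ℕ→R R f w₁ * y)
      * (bernPoly R f l (ℕ→R R f w₃ * y)
      * bernPoly R f m (ℕ→R R f w₂ * y))))
theorem16 R f hom _ _ w₁ w₂ w₃ y n =
  trans (sumTriples-bernPoly≈⋆ n w₃ w₁ w₂ (ι w₁ * y) (ι w₂ * y) (ι w₃ * y))
    (trans (⋆-scaledBernoulli-symmetric w₁ w₂ w₃ y n)
      (sym (sumTriples-bernPoly≈⋆ n w₂ w₁ w₃ (ι w₁ * y) (ι w₃ * y) (ι w₂ * y))))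
  where
  open CommutativeRing R
  open ScaledBernoulli R f hom
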